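{- Let $p$ be a prime, $d\ge1$, and $\mathbf{n} \in \mathbb{Z}^d$. Let $(a_k)_{k\in\mathbb{Z}}$ be elements of $\mathbb{Z}_p$ such that for all $l,s \in \mathbb{Z}$ with $s \geq 0$, \[ \sum_{k:\ \lfloor k/p^s\rfloor = l} a_k \equiv 0 \pmod{p^s}. \] Let $C:\mathbb{Z}^d\times\mathbb{Z}\to\mathbb{Z}_p$ be such that for all $k, r \in \mathbb{Z}$ with $r \geq 1$, \[ C(p^r\mathbf{n}; k) \equiv C(p^{r-1}\mathbf{n}; \lfloor k/p\rfloor) \pmod{p^r}. \] Then for all $r,l \in \mathbb{Z}$ with $r \geq 0$, \[ \sum_{k:\ \lfloor k/p^r\rfloor = l} a_k\, C(p^r\mathbf{n}; k) \equiv 0 \pmod{p^r}. \]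
   Context: $\mathbb{Z}_p$ denotes the $p$-adic integers and $\lfloor x\rfloor$ the floor function; for fixed $l$ and $s\ge0$ the sums run over the $p^s$ integers $k$ with $lp^s\le k< (l+1)p^s$. -}

module Defs where

open import Data.Nat as ℕ using (ℕ; zero; suc; _^_)
open import Data.Nat.Primality using (Prime; prime⇒nonZero)
open import Data.Integer using (ℤ; +_; _+_; _-_; _*_; 0ℤ)
open import Data.Integer.DivMod using (_/ℕ_)
open import Data.Integer.Divisibility.Signed using (_∣_; ∣m∣n⇒∣m+n; ∣n⇒∣m*n; ∣m⇒∣m*n)
open import Data.Integer.Solver using (module +-*-Solver)
open import Data.Fin using (Fin)
open import Relation.Binary.PropositionalEquality using (_≡_; subst)

-- p-adic integers ℤ_p, represented as coherent sequences of integer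
-- approximations:  x = (x₀, x₁, x₂, …) with  x_{n+1} ≡ x_n (mod pⁿ).
-- The element represented is the p-adic limit of the x_n, and it
-- satisfies  x ≡ x_n (mod pⁿ)  in ℤ_p for every n.

record ℤp (p : ℕ) : Set where
  constructor mkℤp
  field
    seq : ℕ → ℤ
    coh : ∀ n → (+ (p ^ n)) ∣ (seq (suc n) - seq n)

open ℤp public

private
  open +-*-Solver

  add-lem : ∀ a b c d → (a + b) - (c + d) ≡ (a - c) + (b - d)
  add-lem = solve 4 (λ a b c d → (a :+ b) :- (c :+ d) := (a :- c) :+ (b :- d)) Relation.Binary.PropositionalEquality.refl

  mul-lem : ∀ a b c d → (a * b) - (c * d) ≡ a * (b - d) + (a - c) * d
  mul-lem = solve 4 (λ a b c d → (a :* b) :- (c :* d) := a :* (b :- d) :+ (a :- c) :* d) Relation.Binary.PropositionalEquality.refl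

  zero-lem : 0ℤ - 0ℤ ≡ 0ℤ * 0ℤ
  zero-lem = Relation.Binary.PropositionalEquality.refl

0ₚ : ∀ {p} → ℤp p
0ₚ {p} = mkℤp (λ _ → 0ℤ) (λ n → subst (λ z → (+ (p ^ n)) ∣ z) (Relation.Binary.PropositionalEquality.sym zero-lem) (∣n⇒∣m*n 0ℤ (∣m⇒∣m*n {+ (p ^ n)} {+ (p ^ n)} 0ℤ (Data.Integer.Divisibility.Signed.∣-refl))))
  where import Data.Integer.Divisibility.Signed

infixl 6 _+ₚ_
infixl 7 _*ₚ_

_+ₚ_ : ∀ {p} → ℤp p → ℤp p → ℤp p
_+ₚ_ {p} x y = mkℤp (λ n → seq x n + seq y n)
  (λ n → subst (λ z → (+ (p ^ n)) ∣ z)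
     (Relation.Binary.PropositionalEquality.sym (add-lem (seq x (suc n)) (seq y (suc n)) (seq x n) (seq y n)))
     (∣m∣n⇒∣m+n (coh x n) (coh y n)))

_*ₚ_ : ∀ {p} → ℤp p → ℤp p → ℤp p
_*ₚ_ {p} x y = mkℤp (λ n → seq x n * seq y n)
  (λ n → subst (λ z → (+ (p ^ n)) ∣ z)
     (Relation.Binary.PropositionalEquality.sym (mul-lem (seq x (suc n)) (seq y (suc n)) (seq x n) (seq y n)))
     (∣m∣n⇒∣m+n (∣n⇒∣m*n (seq x (suc n)) (coh y n)) (∣m⇒∣m*n (seq y n) (coh x n))))

Σₚ : ∀ {p} → ℕ → (ℕ → ℤp p) → ℤp p
Σₚ zero    f = 0ₚ
Σₚ (suc N) f = Σₚ N f +ₚ f N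

-- congruence modulo p^s in ℤ_p:  x ≡ y (mod p^s)  iff  p^s ∣ x_s - y_s
-- (since x ≡ x_s and y ≡ y_s mod p^s in ℤ_p).
_≡_[mod-p^_] : ∀ {p} → ℤp p → ℤp p → ℕ → Set
_≡_[mod-p^_] {p} x y s = (+ (p ^ s)) ∣ (seq x s - seq y s)

-- the sum  Σ_{k : ⌊k/p^s⌋ = l} f k  over the p^s integers k with
-- l p^s ≤ k < (l+1) p^s, written as k = l p^s + j, 0 ≤ j < p^s.
blockSum : ∀ {p} → ℕ → ℤ → (ℤ → ℤp p) → ℤp p
blockSum {p} s l f = Σₚ (p ^ s) (λ j → f (l * + (p ^ s) + + j))

⌊_/prime_⌋ : ℤ → ∀ {p} → Prime p → ℤ
⌊ k /prime pp ⌋ = _/ℕ_ k _ {{prime⇒nonZero pp}}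

_·ᵥ_ : ∀ {d} → ℤ → (Fin d → ℤ) → (Fin d → ℤ)
(m ·ᵥ n) i = m * n i

module Submission where

-- Everything is reduced to the integers by looking at
-- the r-th approximations of the p-adic numbers involved: a congruence
-- modulo p^s with s ≤ r between p-adic integers is a congruence modulo p^s
-- between their r-th approximations.  Over ℤ we prove the stronger,
-- inductive statement (Lemma 5.6 with an extra exponent e):
--
--   if every block sum of A of level s ≤ r is divisible by p^(e+s), and
--   g(t+1, k) ≡ g(t, ⌊k/p⌋) (mod p^(t+1)) for t < r, then every block sum
--   of level r of  k ↦ A(k) · g(r, k)  is divisible by p^(e+r).
--
-- Induction step: replace g(r+1, k) by g(r, ⌊k/p⌋) (each A(k) is divisible
-- by p^e, so this costs only a multiple of p^(e+r+1)); the resulting sum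
-- regroups as a level-r block sum of  m ↦ B(m) · g(r, m),  where
-- B(m) = Σ_{u<p} A(mp+u) has block sums divisible by one more power of p.

open import Defs
open import Data.Nat using (ℕ; suc; _^_; _≤_)
open import Data.Nat.Primality using (Prime)
open import Data.Integer using (ℤ; +_)
open import Data.Fin using (Fin)

import Data.Nat as N
import Data.Nat.Properties as NP
open import Data.Nat.Primality using (prime⇒nonZero)
open import Data.Integer using (_+_; _-_; _*_; 0ℤ)
import Data.Integer as Z
import Data.Integer.Properties as ZP
open import Data.Integer.DivMod using (_/ℕ_; [n/ℕd]*d≤n; n<s[n/ℕd]*d)
open import Data.Integer.Divisibility.Signed
open import Data.Integer.Solver using (module +-*-Solver)
open import Data.Sum using (inj₁; inj₂)
open import Relation.Binary.PropositionalEquality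

open +-*-Solver

-- Congruence of integers:  x ≡ y (mod d)  iff  d ∣ x - y.  (A record, so
-- that x and y can be inferred from the type of a congruence.)
infix 4 _≡_[mod_]
record _≡_[mod_] (x y d : ℤ) : Set where
  constructor by-∣
  field ∣-diff : d ∣ x - y
open _≡_[mod_]

≡mod-refl : ∀ {d} x → x ≡ x [mod d ]
≡mod-refl {d} x = by-∣ (subst (d ∣_) (sym (ZP.+-inverseʳ x)) (divides 0ℤ (sym (ZP.*-zeroˡ d))))

≡mod-trans : ∀ {d x y z} → x ≡ y [mod d ] → y ≡ z [mod d ] → x ≡ z [mod d ]
≡mod-trans {d} {x} {y} {z} (by-∣ d∣x-y) (by-∣ d∣y-z) = by-∣
  (subst (d ∣_) (solve 3 (λ x y z → (x :- y) :+ (y :- z) := x :- z) refl x y z)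
    (∣m∣n⇒∣m+n d∣x-y d∣y-z))

≡mod-sym : ∀ {d x y} → x ≡ y [mod d ] → y ≡ x [mod d ]
≡mod-sym {d} {x} {y} (by-∣ d∣x-y) = by-∣
  (subst (d ∣_) (solve 2 (λ x y → :- (x :- y) := y :- x) refl x y) (∣m⇒∣-m d∣x-y))

≡mod-+ : ∀ {d x y x′ y′} → x ≡ y [mod d ] → x′ ≡ y′ [mod d ] → x + x′ ≡ y + y′ [mod d ]
≡mod-+ {d} {x} {y} {x′} {y′} (by-∣ d∣x-y) (by-∣ d∣x′-y′) = by-∣
  (subst (d ∣_) (solve 4 (λ x y x′ y′ → (x :- y) :+ (x′ :- y′) := (x :+ x′) :- (y :+ y′)) refl x y x′ y′)
    (∣m∣n⇒∣m+n d∣x-y d∣x′-y′))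

≡mod-*ˡ : ∀ {a b x y y′} → a ∣ x → y ≡ y′ [mod b ] → x * y ≡ x * y′ [mod a * b ]
≡mod-*ˡ {a} {b} {x} {y} {y′} (divides q x≡qa) (by-∣ (divides q′ y-y′≡q′b)) =
  by-∣ (divides (q * q′) (begin
    x * y - x * y′       ≡⟨ solve 3 (λ x y y′ → x :* y :- x :* y′ := x :* (y :- y′)) refl x y y′ ⟩
    x * (y - y′)         ≡⟨ cong₂ _*_ x≡qa y-y′≡q′b ⟩
    (q * a) * (q′ * b)   ≡⟨ solve 4 (λ q a q′ b → (q :* a) :* (q′ :* b) := (q :* q′) :* (a :* b)) refl q a q′ b ⟩
    (q * q′) * (a * b)   ∎))
  where open ≡-Reasoning

∣-resp-≡mod : ∀ {d x y} → x ≡ y [mod d ] → d ∣ y → d ∣ x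
∣-resp-≡mod {d} {x} {y} (by-∣ d∣x-y) d∣y =
  subst (d ∣_) (solve 2 (λ x y → (x :- y) :+ y := x) refl x y) (∣m∣n⇒∣m+n d∣x-y d∣y)

∣⇒≡0 : ∀ {d x} → d ∣ x → x ≡ 0ℤ [mod d ]
∣⇒≡0 {d} {x} d∣x = by-∣ (subst (d ∣_) (sym (ZP.+-identityʳ x)) d∣x)

≡0⇒∣ : ∀ {d x} → x ≡ 0ℤ [mod d ] → d ∣ x
≡0⇒∣ {d} {x} (by-∣ d∣x-0) = subst (d ∣_) (ZP.+-identityʳ x) d∣x-0

∑ : ℕ → (ℕ → ℤ) → ℤ
∑ N.zero    f = 0ℤ
∑ (N.suc N) f = ∑ N f + f N

∑-cong< : ∀ N {f g : ℕ → ℤ} → (∀ j → j N.< N → f j ≡ g j) → ∑ N f ≡ ∑ N g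
∑-cong< N.zero    f≡g = refl
∑-cong< (N.suc N) f≡g =
  cong₂ _+_ (∑-cong< N (λ j j<N → f≡g j (NP.m≤n⇒m≤1+n j<N))) (f≡g N NP.≤-refl)

∑-cong : ∀ N {f g : ℕ → ℤ} → (∀ j → f j ≡ g j) → ∑ N f ≡ ∑ N g
∑-cong N f≡g = ∑-cong< N (λ j _ → f≡g j)

∑-*ʳ : ∀ N (f : ℕ → ℤ) c → ∑ N (λ j → f j * c) ≡ ∑ N f * c
∑-*ʳ N.zero    f c = sym (ZP.*-zeroˡ c)
∑-*ʳ (N.suc N) f c =
  trans (cong (_+ f N * c) (∑-*ʳ N f c)) (sym (ZP.*-distribʳ-+ c (∑ N f) (f N)))

∑-split : ∀ a b (f : ℕ → ℤ) → ∑ (a N.+ b) f ≡ ∑ a f + ∑ b (λ j → f (a N.+ j))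
∑-split a N.zero    f rewrite NP.+-identityʳ a = sym (ZP.+-identityʳ (∑ a f))
∑-split a (N.suc b) f rewrite NP.+-suc a b =
  trans (cong (_+ f (a N.+ b)) (∑-split a b f))
        (ZP.+-assoc (∑ a f) (∑ b (λ j → f (a N.+ j))) (f (a N.+ b)))

∑-blocks : ∀ p N (f : ℕ → ℤ) → ∑ (p N.* N) f ≡ ∑ N (λ m → ∑ p (λ u → f (p N.* m N.+ u)))
∑-blocks p N.zero    f rewrite NP.*-zeroʳ p = refl
∑-blocks p (N.suc N) f rewrite NP.*-suc p N | NP.+-comm p (p N.* N) =
  trans (∑-split (p N.* N) p f) (cong (_+ ∑ p (λ u → f (p N.* N N.+ u))) (∑-blocks p N f))

∑-cong-mod : ∀ {d} N {f g : ℕ → ℤ} → (∀ j → f j ≡ g j [mod d ]) → ∑ N f ≡ ∑ N g [mod d ]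
∑-cong-mod N.zero    f≡g = ≡mod-refl 0ℤ
∑-cong-mod (N.suc N) f≡g = ≡mod-+ (∑-cong-mod N f≡g) (f≡g N)

seq-Σₚ : ∀ {p} N (f : ℕ → ℤp p) m → seq (Σₚ N f) m ≡ ∑ N (λ j → seq (f j) m)
seq-Σₚ N.zero    f m = refl
seq-Σₚ (N.suc N) f m = cong (_+ seq (f N) m) (seq-Σₚ N f m)

module Powers (p : ℕ) where

  p^_ : ℕ → ℤ
  p^ n = + (p ^ n)

  p^-+ : ∀ a b → p^ (a N.+ b) ≡ p^ a * p^ b
  p^-+ a b = trans (cong +_ (NP.^-distribˡ-+-* p a b)) (ZP.pos-* (p ^ a) (p ^ b))

  p^-mono-∣ : ∀ {s m} → s ≤ m → p^ s ∣ p^ m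
  p^-mono-∣ {s} {m} s≤m = subst (λ k → p^ s ∣ p^ k) (NP.m+[n∸m]≡n s≤m)
    (subst (p^ s ∣_) (sym (p^-+ s (m N.∸ s))) (∣m⇒∣m*n (p^ (m N.∸ s)) ∣-refl))

  p^-cong-∣ : ∀ {m n x} → m ≡ n → p^ m ∣ x → p^ n ∣ x
  p^-cong-∣ refl p^m∣x = p^m∣x

  seq-coherent : (x : ℤp p) → ∀ {s m} → s ≤ m → seq x m ≡ seq x s [mod p^ s ]
  seq-coherent x {s} {N.zero}  N.z≤n = ≡mod-refl (seq x 0)
  seq-coherent x {s} {N.suc m} s≤1+m with NP.m≤n⇒m<n∨m≡n s≤1+m
  ... | inj₂ refl = ≡mod-refl (seq x (N.suc m))
  ... | inj₁ s<1+m =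
    ≡mod-trans (by-∣ (∣-trans (p^-mono-∣ s≤m) (coh x m))) (seq-coherent x s≤m)
    where s≤m = N.s≤s⁻¹ s<1+m

  seq-≡mod : ∀ (x y : ℤp p) {s m} → x ≡ y [mod-p^ s ] → s ≤ m → seq x m ≡ seq y m [mod p^ s ]
  seq-≡mod x y x≡y s≤m =
    ≡mod-trans (seq-coherent x s≤m) (≡mod-trans (by-∣ x≡y) (≡mod-sym (seq-coherent y s≤m)))

/ℕ-digit : ∀ p .{{_ : N.NonZero p}} q u → u N.< p → (q * + p + + u) /ℕ p ≡ q
/ℕ-digit p q u u<p = ZP.≤-antisym (<-suc⇒≤ k/p<1+q) (<-suc⇒≤ q<1+k/p)
  where
  k = q * + p + + u
  <-suc⇒≤ : ∀ {i j} → i Z.< Z.suc j → i Z.≤ j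
  <-suc⇒≤ {i} {j} i<1+j = subst (i Z.≤_) (ZP.pred-suc j) (ZP.i<j⇒i≤pred[j] i<1+j)
  k<[1+q]p : k Z.< Z.suc q * + p
  k<[1+q]p = subst (k Z.<_) (solve 2 (λ q p → q :* p :+ p := (con (+ 1) :+ q) :* p) refl q (+ p))
               (ZP.+-monoʳ-< (q * + p) (Z.+<+ u<p))
  qp≤k : q * + p Z.≤ k
  qp≤k = subst (q * + p Z.≤_) (ZP.+-comm (+ u) (q * + p)) (ZP.i≤j⇒i≤k+j (+ u) ZP.≤-refl)
  k/p<1+q : k /ℕ p Z.< Z.suc q
  k/p<1+q = ZP.*-cancelʳ-<-nonNeg (+ p) (ZP.≤-<-trans ([n/ℕd]*d≤n k p) k<[1+q]p)
  q<1+k/p : q Z.< Z.suc (k /ℕ p)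
  q<1+k/p = ZP.*-cancelʳ-<-nonNeg (+ p) (ZP.≤-<-trans qp≤k (n<s[n/ℕd]*d k p))

module BlockSums (p : ℕ) .{{_ : N.NonZero p}} where

  open Powers p

  block : ℕ → ℤ → (ℤ → ℤ) → ℤ
  block s l f = ∑ (p ^ s) (λ j → f (l * p^ s + + j))

  coarsen : (ℤ → ℤ) → ℤ → ℤ
  coarsen A m = ∑ p (λ u → A (m * + p + + u))

  block-index : ∀ r l m u → l * p^ suc r + + (p N.* m N.+ u) ≡ (l * p^ r + + m) * + p + + u
  block-index r l m u = begin
      l * p^ suc r + + (p N.* m N.+ u)
        ≡⟨ cong₂ (λ x y → l * x + y) (ZP.pos-* p (p ^ r))
             (trans (ZP.pos-+ (p N.* m) u) (cong (_+ + u) (ZP.pos-* p m))) ⟩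
      l * (+ p * p^ r) + (+ p * + m + + u)
        ≡⟨ solve 5 (λ l p q m u → l :* (p :* q) :+ (p :* m :+ u) := (l :* q :+ m) :* p :+ u)
             refl l (+ p) (p^ r) (+ m) (+ u) ⟩
      (l * p^ r + + m) * + p + + u ∎
    where open ≡-Reasoning

  block-suc : ∀ s l (A : ℤ → ℤ) (h : ℤ → ℤ) →
              block (suc s) l (λ k → A k * h (k /ℕ p)) ≡ block s l (λ m → coarsen A m * h m)
  block-suc s l A h = trans (∑-blocks p (p ^ s) _) (∑-cong (p ^ s) regroup)
    where
    regroup : ∀ m → ∑ p (λ u → A (l * p^ suc s + + (p N.* m N.+ u)) * h ((l * p^ suc s + + (p N.* m N.+ u)) /ℕ p))
                  ≡ coarsen A (l * p^ s + + m) * h (l * p^ s + + m)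
    regroup m = begin
        ∑ p (λ u → A (l * p^ suc s + + (p N.* m N.+ u)) * h ((l * p^ suc s + + (p N.* m N.+ u)) /ℕ p))
          ≡⟨ ∑-cong< p (λ u u<p → cong (λ k → A k * h (k /ℕ p)) (block-index s l m u)) ⟩
        ∑ p (λ u → A (Q * + p + + u) * h ((Q * + p + + u) /ℕ p))
          ≡⟨ ∑-cong< p (λ u u<p → cong (λ q → A (Q * + p + + u) * h q) (/ℕ-digit p Q u u<p)) ⟩
        ∑ p (λ u → A (Q * + p + + u) * h Q)
          ≡⟨ ∑-*ʳ p (λ u → A (Q * + p + + u)) (h Q) ⟩
        coarsen A Q * h Q ∎
      where
      open ≡-Reasoning
      Q = l * p^ s + + m

  BlockDivisible : ℕ → ℕ → (ℤ → ℤ) → Set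
  BlockDivisible r e A = ∀ s l → s ≤ r → p^ (e N.+ s) ∣ block s l A

  FloorCoherent : ℕ → (ℕ → ℤ → ℤ) → Set
  FloorCoherent r g = ∀ t k → suc t ≤ r → g (suc t) k ≡ g t (k /ℕ p) [mod p^ suc t ]

  -- Level-0 blocks are single values: each A k is divisible by p^e.
  BlockDivisible⇒∣ : ∀ {r e A} → BlockDivisible r e A → ∀ k → p^ e ∣ A k
  BlockDivisible⇒∣ {e = e} {A = A} A-div k =
    subst₂ (λ n x → p^ n ∣ x) (NP.+-identityʳ e)
      (trans (ZP.+-identityˡ _) (cong A (trans (ZP.+-identityʳ (k * + 1)) (ZP.*-identityʳ k))))
      (A-div 0 k N.z≤n)

  coarsen-BlockDivisible : ∀ {r e A} → BlockDivisible (suc r) e A → BlockDivisible r (suc e) (coarsen A)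
  coarsen-BlockDivisible {e = e} {A = A} A-div s l s≤r =
    subst₂ (λ n x → p^ n ∣ x) (NP.+-suc e s)
      (trans (∑-blocks p (p ^ s) _) (∑-cong (p ^ s) (λ m → ∑-cong p (λ u → cong A (block-index s l m u)))))
      (A-div (suc s) l (N.s≤s s≤r))

  block-product-∣ : ∀ r e (A : ℤ → ℤ) (g : ℕ → ℤ → ℤ) → BlockDivisible r e A → FloorCoherent r g →
                    ∀ l → p^ (e N.+ r) ∣ block r l (λ k → A k * g r k)
  block-product-∣ N.zero e A g A-div g-coh l =
    subst (p^ (e N.+ 0) ∣_) (sym (ZP.+-identityˡ _))
      (∣m⇒∣m*n _ (p^-cong-∣ (sym (NP.+-identityʳ e)) (BlockDivisible⇒∣ {e = e} {A} A-div (l * p^ 0 + + 0))))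
  block-product-∣ (N.suc r) e A g A-div g-coh l =
    ∣-resp-≡mod (∑-cong-mod (p ^ suc r) lower-level)
      (subst (p^ (e N.+ suc r) ∣_) (sym (block-suc r l A (g r)))
        (p^-cong-∣ (sym (NP.+-suc e r)) coarse))
    where
    lower-level : ∀ j → let k = l * p^ suc r + + j in
                  A k * g (suc r) k ≡ A k * g r (k /ℕ p) [mod p^ (e N.+ suc r) ]
    lower-level j = subst (_≡_[mod_] _ _) (sym (p^-+ e (suc r)))
      (≡mod-*ˡ (BlockDivisible⇒∣ {e = e} {A} A-div _) (g-coh r _ NP.≤-refl))
    coarse : p^ (suc e N.+ r) ∣ block r l (λ m → coarsen A m * g r m)
    coarse = block-product-∣ r (suc e) (coarsen A) g (coarsen-BlockDivisible {e = e} {A} A-div)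
               (λ t k t<r → g-coh t k (NP.m≤n⇒m≤1+n t<r)) l

lemma5p6 : (p : ℕ) (pp : Prime p) (d : ℕ) → 1 ≤ d → (n : Fin d → ℤ)
    → (a : ℤ → ℤp p)
    → (∀ (l : ℤ) (s : ℕ) → blockSum s l a ≡ 0ₚ [mod-p^ s ])
    → (C : (Fin d → ℤ) → ℤ → ℤp p)
    → (∀ (k : ℤ) (r : ℕ) → C ((+ (p ^ suc r)) ·ᵥ n) k ≡ C ((+ (p ^ r)) ·ᵥ n) ⌊ k /prime pp ⌋ [mod-p^ suc r ])
    → ∀ (r : ℕ) (l : ℤ) → blockSum r l (λ k → a k *ₚ C ((+ (p ^ r)) ·ᵥ n) k) ≡ 0ₚ [mod-p^ r ]
lemma5p6 p pp d _ n a a-blocks C C-floor r l =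
  ∣-diff (∣⇒≡0 (subst (p^ r ∣_) (sym (seq-Σₚ (p ^ r) _ r))
    (block-product-∣ r 0 A g A-div g-coh l)))
  where
  instance _ = prime⇒nonZero pp
  open Powers p
  open BlockSums p
  A : ℤ → ℤ
  A k = seq (a k) r
  g : ℕ → ℤ → ℤ
  g t k = seq (C ((p^ t) ·ᵥ n) k) r
  A-div : BlockDivisible r 0 A
  A-div s l′ s≤r = ≡0⇒∣ (subst (λ x → x ≡ 0ℤ [mod p^ s ]) (seq-Σₚ (p ^ s) _ r)
                     (seq-≡mod (blockSum s l′ a) 0ₚ (a-blocks l′ s) s≤r))
  g-coh : FloorCoherent r g
  g-coh t k t<r = seq-≡mod (C ((p^ suc t) ·ᵥ n) k) (C ((p^ t) ·ᵥ n) (k /ℕ p)) (C-floor k t) t<r
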